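{- Let $K$ be a non-archimedean ordered field with natural valuation $v$, value group $G=v(K)$ and $\Gamma=v_G(G^{<0})$, and let $\sigma\neq\mathrm{id}$ be an order preserving field automorphism of $K$ with $\sigma(a)\ge a^2$ for all $a\in\mathbf{P}_K$. Then $\mathcal{R}_\sigma^{\rm pr}$ is order isomorphic to $(\Gamma/\sim_{\sigma_\Gamma})^*$, the chain $\Gamma/\sim_{\sigma_\Gamma}$ with its order reversed.
   Context: $v$ has valuation ring $R_v$ = convex hull of $\mathbb{Q}$ in $K$, with $a\ge b>0\Rightarrow v(a)\le v(b)$; $\mathbf{P}_K:=K^{>0}\setminus R_v$. $\sigma_G(v(a)):=v(\sigma(a))$. $v_G$ is archimedean equivalence on $G^{<0}$ ($g\sim g'$ iff $\exists n$: $2^ng\le g'$ and $2^ng'\le g$), $\Gamma$ the set of classes with the induced order; $\sigma_\Gamma(v_G(g)):=v_G(\sigma_G(g))$, which satisfies $\sigma_\Gamma(\gamma)\le\gamma$. $\gamma\sim_{\sigma_\Gamma}\gamma'$ iff $\exists n\in\mathbb{N}_0$ with $\sigma_\Gamma^n(\gamma)\le\gamma'$ and $\sigma_\Gamma^n(\gamma')\le\gamma$; the quotient carries the induced order. A valuation $w$ is convex if $a\ge b>0\Rightarrow w(a)\le w(b)$ and $\sigma$-compatible if $w(a)\le w(b)\iff w(\sigma(a))\le w(\sigma(b))$. A $\sigma$-compatible convex valuation ring $R_w\neq R_v$ is $\sigma$-principal if it is the smallest $\sigma$-compatible convex subring of $K$ containing some $a\in\mathbf{P}_K$; $\mathcal{R}_\sigma^{\rm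 pr}$ is the set of these, ordered by inclusion. -}

module Defs where

open import Level using (0ℓ)
open import Data.Nat using (ℕ; zero; suc)
open import Data.Product using (Σ; ∃; _×_; _,_; proj₁)
open import Data.Sum using (_⊎_)
open import Relation.Nullary using (¬_)
open import Relation.Binary.PropositionalEquality using (_≡_; _≢_)
open import Relation.Binary.Structures using (IsTotalOrder)
open import Algebra.Structures using (IsCommutativeRing)
open import Function.Bundles using (_⇔_)

record OrderedField : Set₁ where
  infixl 6 _+_
  infixl 7 _*_
  infix 4 _≤_ _<_
  field
    Carrier : Set
    _+_ _*_ : Carrier → Carrier → Carrier
    -_      : Carrier → Carrier
    0# 1#   : Carrier
    _≤_     : Carrier → Carrier → Set
    isCommutativeRing : IsCommutativeRing _≡_ _+_ _*_ -_ 0# 1#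
    0≢1     : 0# ≢ 1#
    inverse : ∀ x → x ≢ 0# → ∃ λ y → x * y ≡ 1#
    isTotalOrder : IsTotalOrder _≡_ _≤_
    +-mono-≤ : ∀ {x y} z → x ≤ y → x + z ≤ y + z
    *-nonneg : ∀ {x y} → 0# ≤ x → 0# ≤ y → 0# ≤ x * y

  _<_ : Carrier → Carrier → Set
  x < y = x ≤ y × x ≢ y

  fromℕ : ℕ → Carrier
  fromℕ zero    = 0#
  fromℕ (suc n) = 1# + fromℕ n

  _^_ : Carrier → ℕ → Carrier
  x ^ zero  = 1#
  x ^ suc n = x * (x ^ n)

  2^ : ℕ → ℕ
  2^ zero    = 1
  2^ (suc n) = 2^ n Data.Nat.+ 2^ n

module _ (K : OrderedField) where
  open OrderedField K

  Subset : Set₁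
  Subset = Carrier → Set

  _⊆_ : Subset → Subset → Set
  R ⊆ S = ∀ x → R x → S x

  -- natural valuation ring R_v: convex hull of ℚ (equivalently of ℤ) in K
  Rv : Subset
  Rv x = ∃ λ (n : ℕ) → (- fromℕ n ≤ x) × (x ≤ fromℕ n)

  NonArchimedean : Set
  NonArchimedean = ∃ λ (a : Carrier) → ¬ Rv a

  P : Subset
  P a = (0# < a) × ¬ Rv a

  -- the valuation w = w_R attached to a valuation ring R:
  --   w(a) ≤ w(b)  iff  b = r·a for some r ∈ R
  wle : Subset → Carrier → Carrier → Set
  wle R a b = ∃ λ r → R r × (b ≡ r * a)

  IsSubring : Subset → Set
  IsSubring R = R 0# × R 1# × (∀ x y → R x → R y → R (x + y))
              × (∀ x y → R x → R y → R (x * y)) × (∀ x → R x → R (- x))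

  IsConvex : Subset → Set
  IsConvex R = ∀ x y z → R x → R z → x ≤ y → y ≤ z → R y

  IsValuationRing : Subset → Set
  IsValuationRing R = IsSubring R
    × (∀ x → x ≢ 0# → R x ⊎ (∃ λ y → (x * y ≡ 1#) × R y))

  IsOrderPreservingAutomorphism : (Carrier → Carrier) → Set
  IsOrderPreservingAutomorphism σ =
      (∀ x y → σ (x + y) ≡ σ x + σ y)
    × (∀ x y → σ (x * y) ≡ σ x * σ y)
    × (σ 1# ≡ 1#)
    × (∀ x y → σ x ≡ σ y → x ≡ y)
    × (∀ y → ∃ λ x → σ x ≡ y)
    × (∀ x y → x ≤ y → σ x ≤ σ y)

  module _ (σ : Carrier → Carrier) where

    IsσCompatible : Subset → Set
    IsσCompatible R = ∀ a b → wle R a b ⇔ wle R (σ a) (σ b)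

    IsσPrincipal : Subset → Set₁
    IsσPrincipal R =
        IsValuationRing R × IsConvex R × IsσCompatible R
      × ¬ (R ⊆ Rv × Rv ⊆ R)
      × ∃ λ a → P a × R a
          × (∀ (S : Subset) → IsSubring S → IsConvex S → IsσCompatible S
               → S a → R ⊆ S)

    Rpr : Set₁
    Rpr = Σ Subset IsσPrincipal

    σ^ : ℕ → Carrier → Carrier
    σ^ zero    x = x
    σ^ (suc n) x = σ (σ^ n x)

    -- Elements of G^{<0} are the values v(a), a ∈ 𝐏_K.  We represent
    -- elements of Γ and of Γ/∼_{σ_Γ} by such representatives a ∈ 𝐏_K.

    vle : Carrier → Carrier → Set
    vle = wle Rv

    -- archimedean equivalence of v(a), v(b) in G^{<0}  (2^n·v(a) = v(a^{2^n}))
    archEq : Carrier → Carrier → Set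
    archEq a b = ∃ λ n → vle (a ^ 2^ n) b × vle (b ^ 2^ n) a

    -- induced order on Γ: v_G(v a) ≤ v_G(v b)
    Γle : Carrier → Carrier → Set
    Γle a b = vle a b ⊎ archEq a b

    -- σ_Γ(v_G(v a)) = v_G(v(σ a));  γ ∼_{σ_Γ} γ'
    σΓEq : Carrier → Carrier → Set
    σΓEq a b = ∃ λ n → Γle (σ^ n a) b × Γle (σ^ n b) a

    Q : Set
    Q = Σ Carrier P

    _≤Q_ : Q → Q → Set
    (a , _) ≤Q (b , _) = Γle a b ⊎ σΓEq a b

    _≈Q_ : Q → Q → Set
    (a , _) ≈Q (b , _) = σΓEq a b

    OrderIsoToReversed : Set₁
    OrderIsoToReversed =
      Σ (Rpr → Q) λ f →
          (∀ (R R' : Rpr) → (proj₁ R ⊆ proj₁ R') ⇔ (f R' ≤Q f R))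
        × (∀ (q : Q) → ∃ λ (R : Rpr) → f R ≈Q q)

-- For infinitely large x the hypothesis σ x ≥ x² gives x + x ≤ σ x and x · x ≤ σ x.
-- Hence every a ∈ 𝐏_K generates the ring ⟨a⟩ = ⋃ₘ [-σᵐ a, σᵐ a]: it is a convex
-- σ-compatible valuation ring, and it is contained in every convex σ-compatible
-- subring containing a, so it is the σ-principal ring of a.  Conversely a convex
-- σ-compatible subring containing b contains every x with [b] ≤ [x] in Γ/∼_{σ_Γ}
-- (it contains R_v, powers and σ-iterates of b).  So sending a σ-principal ring to
-- its generator reverses inclusion: ⟨a⟩ ⊆ ⟨b⟩ iff a ≤ σᵐ b for some m iff [b] ≤ [a].
module Submission where

open import Defs
open import Data.Product using (_×_)
open import Relation.Nullary using (¬_)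
open import Relation.Binary.PropositionalEquality using (_≡_)

open import Level using (0ℓ)
open import Data.Nat using (zero; suc; _⊔_; _≤′_; ≤′-refl; ≤′-step)
open import Data.Nat.Properties using (≤⇒≤′; z≤′n; m≤m⊔n; m≤n⊔m)
open import Data.Product using (∃; _,_; proj₁; proj₂)
open import Data.Sum using (_⊎_; inj₁; inj₂)
open import Data.Empty using (⊥-elim)
open import Relation.Binary.PropositionalEquality
  using (_≢_; refl; sym; trans; cong; cong₂; subst; subst₂)
open import Relation.Binary.Structures using (IsTotalOrder)
open import Function.Bundles using (_⇔_; mk⇔; Equivalence)
open import Algebra.Bundles using (CommutativeRing)
open import Algebra.Structures using (IsCommutativeRing)
import Algebra.Properties.Ring as RingProperties

module _ (K : OrderedField) where
  open OrderedField K

  private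
    commutativeRing : CommutativeRing 0ℓ 0ℓ
    commutativeRing = record
      { Carrier = Carrier ; _≈_ = _≡_ ; _+_ = _+_ ; _*_ = _*_ ; -_ = -_
      ; 0# = 0# ; 1# = 1# ; isCommutativeRing = isCommutativeRing }

  open IsCommutativeRing isCommutativeRing using
    ( +-assoc ; +-comm ; +-identityˡ ; +-identityʳ ; -‿inverseˡ ; -‿inverseʳ
    ; *-assoc ; *-comm ; *-identityˡ ; *-identityʳ ; distribˡ ; distribʳ ; zeroʳ )
  open RingProperties (CommutativeRing.ring commutativeRing) using
    ( -0#≈0# ; -‿involutive ; -‿anti-homo-+ ; x+x≈x⇒x≈0
    ; +-inverseʳ-unique ; -‿distribˡ-* ; -‿distribʳ-* )
  open IsTotalOrder isTotalOrder using (total; antisym)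
    renaming (refl to ≤-refl; reflexive to ≤-reflexive; trans to ≤-trans)

  +-monoʳ-≤ : ∀ {x y} z → x ≤ y → z + x ≤ z + y
  +-monoʳ-≤ {x} {y} z p = subst₂ _≤_ (+-comm x z) (+-comm y z) (+-mono-≤ z p)

  +-mono₂-≤ : ∀ {x y u w} → x ≤ y → u ≤ w → x + u ≤ y + w
  +-mono₂-≤ {y = y} {u} p q = ≤-trans (+-mono-≤ u p) (+-monoʳ-≤ y q)

  +-cancelʳ-≤ : ∀ {x y} z → x + z ≤ y + z → x ≤ y
  +-cancelʳ-≤ {x} {y} z p = subst₂ _≤_ (x+z-z≡x x) (x+z-z≡x y) (+-mono-≤ (- z) p)
    where
    x+z-z≡x : ∀ x → (x + z) + - z ≡ x
    x+z-z≡x x = trans (+-assoc x z (- z)) (trans (cong (x +_) (-‿inverseʳ z)) (+-identityʳ x))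

  x≤y⇒0≤y-x : ∀ {x y} → x ≤ y → 0# ≤ y + - x
  x≤y⇒0≤y-x {x} p = subst (_≤ _) (-‿inverseʳ x) (+-mono-≤ (- x) p)

  0≤y-x⇒x≤y : ∀ {x y} → 0# ≤ y + - x → x ≤ y
  0≤y-x⇒x≤y {x} {y} p = subst₂ _≤_ (+-identityˡ x) y-x+x≡y (+-mono-≤ x p)
    where
    y-x+x≡y : (y + - x) + x ≡ y
    y-x+x≡y = trans (+-assoc y (- x) x) (trans (cong (y +_) (-‿inverseˡ x)) (+-identityʳ y))

  -‿antimono-≤ : ∀ {x y} → x ≤ y → - y ≤ - x
  -‿antimono-≤ {x} {y} p = 0≤y-x⇒x≤y (subst (0# ≤_) y-x≡-x--y (x≤y⇒0≤y-x p))
    where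
    y-x≡-x--y : y + - x ≡ - x + - (- y)
    y-x≡-x--y = trans (+-comm y (- x)) (cong (- x +_) (sym (-‿involutive y)))

  0≤x⇒-x≤0 : ∀ {x} → 0# ≤ x → - x ≤ 0#
  0≤x⇒-x≤0 p = subst (_ ≤_) -0#≈0# (-‿antimono-≤ p)

  x≤0⇒0≤-x : ∀ {x} → x ≤ 0# → 0# ≤ - x
  x≤0⇒0≤-x p = subst (_≤ _) -0#≈0# (-‿antimono-≤ p)

  *-monoʳ-≤-nonNeg : ∀ {x y z} → 0# ≤ z → x ≤ y → z * x ≤ z * y
  *-monoʳ-≤-nonNeg {x} {y} {z} 0≤z p =
    0≤y-x⇒x≤y (subst (0# ≤_) z[y-x]≡zy-zx (*-nonneg 0≤z (x≤y⇒0≤y-x p)))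
    where
    z[y-x]≡zy-zx : z * (y + - x) ≡ z * y + - (z * x)
    z[y-x]≡zy-zx = trans (distribˡ z y (- x)) (cong (z * y +_) (sym (-‿distribʳ-* z x)))

  *-monoˡ-≤-nonNeg : ∀ {x y z} → 0# ≤ z → x ≤ y → x * z ≤ y * z
  *-monoˡ-≤-nonNeg {x} {y} {z} 0≤z p =
    subst₂ _≤_ (*-comm z x) (*-comm z y) (*-monoʳ-≤-nonNeg 0≤z p)

  -x*-y≡x*y : ∀ x y → (- x) * (- y) ≡ x * y
  -x*-y≡x*y x y = trans (sym (-‿distribˡ-* x (- y)))
    (trans (cong -_ (sym (-‿distribʳ-* x y))) (-‿involutive (x * y)))

  0≤1 : 0# ≤ 1#
  0≤1 with total 0# 1#
  ... | inj₁ p = p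
  ... | inj₂ p = subst (0# ≤_) (trans (-x*-y≡x*y 1# 1#) (*-identityˡ 1#))
                   (*-nonneg (x≤0⇒0≤-x p) (x≤0⇒0≤-x p))

  1≰0 : ¬ (1# ≤ 0#)
  1≰0 p = 0≢1 (antisym 0≤1 p)

  x*y≡1⇒0≤x⇒0≤y : ∀ {x y} → x * y ≡ 1# → 0# ≤ x → 0# ≤ y
  x*y≡1⇒0≤x⇒0≤y {x} {y} xy≡1 0≤x with total 0# y
  ... | inj₁ 0≤y = 0≤y
  ... | inj₂ y≤0 = ⊥-elim (1≰0 (subst₂ _≤_ xy≡1 (zeroʳ x) (*-monoʳ-≤-nonNeg 0≤x y≤0)))

  fromℕ-nonNeg : ∀ n → 0# ≤ fromℕ n
  fromℕ-nonNeg zero    = ≤-refl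
  fromℕ-nonNeg (suc n) = subst (_≤ 1# + fromℕ n) (+-identityʳ 0#) (+-mono₂-≤ 0≤1 (fromℕ-nonNeg n))

  Infinite : Carrier → Set
  Infinite x = ∀ n → fromℕ n ≤ x

  Infinite⇒0≤ : ∀ {x} → Infinite x → 0# ≤ x
  Infinite⇒0≤ x∞ = x∞ 0

  Infinite⇒1≤ : ∀ {x} → Infinite x → 1# ≤ x
  Infinite⇒1≤ x∞ = subst (_≤ _) (+-identityʳ 1#) (x∞ 1)

  Infinite-mono : ∀ {x y} → Infinite x → x ≤ y → Infinite y
  Infinite-mono x∞ x≤y n = ≤-trans (x∞ n) x≤y

  Infinite⇒x≤x*x : ∀ {x} → Infinite x → x ≤ x * x
  Infinite⇒x≤x*x {x} x∞ =
    subst (_≤ x * x) (*-identityʳ x) (*-monoʳ-≤-nonNeg (Infinite⇒0≤ x∞) (Infinite⇒1≤ x∞))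

  Infinite⇒x+x≤x*x : ∀ {x} → Infinite x → x + x ≤ x * x
  Infinite⇒x+x≤x*x {x} x∞ = subst (_≤ _) [1+1]x≡x+x (*-monoˡ-≤-nonNeg (Infinite⇒0≤ x∞) 2≤x)
    where
    2≤x : 1# + 1# ≤ x
    2≤x = subst (λ t → 1# + t ≤ x) (+-identityʳ 1#) (x∞ 2)
    [1+1]x≡x+x : (1# + 1#) * x ≡ x + x
    [1+1]x≡x+x = trans (distribʳ x 1# 1#) (cong₂ _+_ (*-identityˡ x) (*-identityˡ x))

  P⇒Infinite : ∀ {x} → P K x → Infinite x
  P⇒Infinite {x} ((0≤x , _) , x∉Rv) n with total (fromℕ n) x
  ... | inj₁ p = p
  ... | inj₂ p = ⊥-elim (x∉Rv (n , ≤-trans (0≤x⇒-x≤0 (fromℕ-nonNeg n)) 0≤x , p))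

  Infinite⇒P : ∀ {x} → Infinite x → P K x
  Infinite⇒P {x} x∞ = (Infinite⇒0≤ x∞ , 0≢x) , x∉Rv
    where
    0≢x : 0# ≢ x
    0≢x 0≡x = 1≰0 (subst (1# ≤_) (sym 0≡x) (Infinite⇒1≤ x∞))
    x∉Rv : ¬ Rv K x
    x∉Rv (n , _ , x≤n) = 1≰0 (+-cancelʳ-≤ (fromℕ n)
      (subst (1# + fromℕ n ≤_) (sym (+-identityˡ (fromℕ n))) (≤-trans (x∞ (suc n)) x≤n)))

  Infinite⇒0< : ∀ {x} → Infinite x → 0# < x
  Infinite⇒0< x∞ = proj₁ (Infinite⇒P x∞)

  infix 4 ∣_∣≤_
  ∣_∣≤_ : Carrier → Carrier → Set
  ∣ t ∣≤ c = (- c ≤ t) × (t ≤ c)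

  ∣∣≤-weaken : ∀ {c c' t} → c ≤ c' → ∣ t ∣≤ c → ∣ t ∣≤ c'
  ∣∣≤-weaken c≤c' (l , u) = ≤-trans (-‿antimono-≤ c≤c') l , ≤-trans u c≤c'

  0≤t≤c⇒∣t∣≤c : ∀ {c t} → 0# ≤ t → t ≤ c → ∣ t ∣≤ c
  0≤t≤c⇒∣t∣≤c 0≤t t≤c = ≤-trans (0≤x⇒-x≤0 (≤-trans 0≤t t≤c)) 0≤t , t≤c

  ∣-t∣≤c : ∀ {c t} → ∣ t ∣≤ c → ∣ - t ∣≤ c
  ∣-t∣≤c {c} {t} (l , u) = -‿antimono-≤ u , subst (- t ≤_) (-‿involutive c) (-‿antimono-≤ l)

  ∣-t∣≤c⇒∣t∣≤c : ∀ {c t} → ∣ - t ∣≤ c → ∣ t ∣≤ c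
  ∣-t∣≤c⇒∣t∣≤c {c} {t} b = subst (∣_∣≤ c) (-‿involutive t) (∣-t∣≤c b)

  ∣+∣≤ : ∀ {c x y} → ∣ x ∣≤ c → ∣ y ∣≤ c → ∣ x + y ∣≤ c + c
  ∣+∣≤ {c} (l , u) (l' , u') =
    subst (_≤ _) (sym (-‿anti-homo-+ c c)) (+-mono₂-≤ l l') , +-mono₂-≤ u u'

  private
    ∣t∣≤c⇒signed : ∀ {c t} → ∣ t ∣≤ c → (0# ≤ t × t ≤ c) ⊎ (0# ≤ - t × - t ≤ c)
    ∣t∣≤c⇒signed {t = t} b with total 0# t
    ... | inj₁ 0≤t = inj₁ (0≤t , proj₂ b)
    ... | inj₂ t≤0 = inj₂ (x≤0⇒0≤-x t≤0 , proj₂ (∣-t∣≤c b))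

    nonNeg-∣*∣≤ : ∀ {c u v} → 0# ≤ u → u ≤ c → 0# ≤ v → v ≤ c → ∣ u * v ∣≤ c * c
    nonNeg-∣*∣≤ 0≤u u≤c 0≤v v≤c = 0≤t≤c⇒∣t∣≤c (*-nonneg 0≤u 0≤v)
      (≤-trans (*-monoˡ-≤-nonNeg 0≤v u≤c) (*-monoʳ-≤-nonNeg (≤-trans 0≤u u≤c) v≤c))

  ∣*∣≤ : ∀ {c x y} → ∣ x ∣≤ c → ∣ y ∣≤ c → ∣ x * y ∣≤ c * c
  ∣*∣≤ {c} {x} {y} bx by with ∣t∣≤c⇒signed bx | ∣t∣≤c⇒signed by
  ... | inj₁ (0≤x , x≤c)   | inj₁ (0≤y , y≤c)   = nonNeg-∣*∣≤ 0≤x x≤c 0≤y y≤c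
  ... | inj₁ (0≤x , x≤c)   | inj₂ (0≤-y , -y≤c) =
    ∣-t∣≤c⇒∣t∣≤c (subst (∣_∣≤ _) (sym (-‿distribʳ-* x y)) (nonNeg-∣*∣≤ 0≤x x≤c 0≤-y -y≤c))
  ... | inj₂ (0≤-x , -x≤c) | inj₁ (0≤y , y≤c)   =
    ∣-t∣≤c⇒∣t∣≤c (subst (∣_∣≤ _) (sym (-‿distribˡ-* x y)) (nonNeg-∣*∣≤ 0≤-x -x≤c 0≤y y≤c))
  ... | inj₂ (0≤-x , -x≤c) | inj₂ (0≤-y , -y≤c) =
    subst (∣_∣≤ c * c) (-x*-y≡x*y x y) (nonNeg-∣*∣≤ 0≤-x -x≤c 0≤-y -y≤c)

  private
    nonNeg-x*y≡1⇒∣x∣≤1⊎∣y∣≤1 : ∀ {x y} → 0# ≤ x → x * y ≡ 1# → ∣ x ∣≤ 1# ⊎ ∣ y ∣≤ 1#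
    nonNeg-x*y≡1⇒∣x∣≤1⊎∣y∣≤1 {x} {y} 0≤x xy≡1 with total x 1# | total y 1#
    ... | inj₁ x≤1 | _ = inj₁ (0≤t≤c⇒∣t∣≤c 0≤x x≤1)
    ... | inj₂ _   | inj₁ y≤1 = inj₂ (0≤t≤c⇒∣t∣≤c (x*y≡1⇒0≤x⇒0≤y xy≡1 0≤x) y≤1)
    ... | inj₂ _   | inj₂ 1≤y = inj₁ (0≤t≤c⇒∣t∣≤c 0≤x
      (subst₂ _≤_ (*-identityʳ x) xy≡1 (*-monoʳ-≤-nonNeg 0≤x 1≤y)))

  x*y≡1⇒∣x∣≤1⊎∣y∣≤1 : ∀ {x y} → x * y ≡ 1# → ∣ x ∣≤ 1# ⊎ ∣ y ∣≤ 1#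
  x*y≡1⇒∣x∣≤1⊎∣y∣≤1 {x} {y} xy≡1 with total 0# x
  ... | inj₁ 0≤x = nonNeg-x*y≡1⇒∣x∣≤1⊎∣y∣≤1 0≤x xy≡1
  ... | inj₂ x≤0 with nonNeg-x*y≡1⇒∣x∣≤1⊎∣y∣≤1 (x≤0⇒0≤-x x≤0) (trans (-x*-y≡x*y x y) xy≡1)
  ...   | inj₁ ∣-x∣≤1 = inj₁ (∣-t∣≤c⇒∣t∣≤c ∣-x∣≤1)
  ...   | inj₂ ∣-y∣≤1 = inj₂ (∣-t∣≤c⇒∣t∣≤c ∣-y∣≤1)

  1∈Rv : Rv K 1#
  1∈Rv = 1 , ≤-trans (0≤x⇒-x≤0 (fromℕ-nonNeg 1)) 0≤1 , subst (1# ≤_) (sym (+-identityʳ 1#)) ≤-refl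

  v[x]≤v[x] : ∀ x → wle K (Rv K) x x
  v[x]≤v[x] x = 1# , 1∈Rv , sym (*-identityˡ x)

  0≤x≤y⇒v[y]≤v[x] : ∀ {x y} → 0# ≤ x → x ≤ y → 0# < y → wle K (Rv K) y x
  0≤x≤y⇒v[y]≤v[x] {x} {y} 0≤x x≤y (0≤y , 0≢y) with inverse y (λ y≡0 → 0≢y (sym y≡0))
  ... | y⁻¹ , yy⁻¹≡1 = x * y⁻¹ , (1 , -1≤xy⁻¹ , xy⁻¹≤1) , x≡xy⁻¹y
    where
    0≤y⁻¹ : 0# ≤ y⁻¹
    0≤y⁻¹ = x*y≡1⇒0≤x⇒0≤y yy⁻¹≡1 0≤y
    -1≤xy⁻¹ : - fromℕ 1 ≤ x * y⁻¹
    -1≤xy⁻¹ = ≤-trans (0≤x⇒-x≤0 (fromℕ-nonNeg 1)) (*-nonneg 0≤x 0≤y⁻¹)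
    xy⁻¹≤1 : x * y⁻¹ ≤ fromℕ 1
    xy⁻¹≤1 = subst (x * y⁻¹ ≤_) (trans yy⁻¹≡1 (sym (+-identityʳ 1#)))
               (*-monoˡ-≤-nonNeg 0≤y⁻¹ x≤y)
    x≡xy⁻¹y : x ≡ (x * y⁻¹) * y
    x≡xy⁻¹y = trans (sym (*-identityʳ x))
      (trans (cong (x *_) (trans (sym yy⁻¹≡1) (*-comm y y⁻¹))) (sym (*-assoc x y⁻¹ y)))

  module _ (σ : Carrier → Carrier) (σ-auto : IsOrderPreservingAutomorphism K σ) where

    σ-+ : ∀ x y → σ (x + y) ≡ σ x + σ y
    σ-+ = proj₁ σ-auto

    σ-* : ∀ x y → σ (x * y) ≡ σ x * σ y
    σ-* = proj₁ (proj₂ σ-auto)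

    σ-1 : σ 1# ≡ 1#
    σ-1 = proj₁ (proj₂ (proj₂ σ-auto))

    σ-injective : ∀ x y → σ x ≡ σ y → x ≡ y
    σ-injective = proj₁ (proj₂ (proj₂ (proj₂ σ-auto)))

    σ-surjective : ∀ y → ∃ λ x → σ x ≡ y
    σ-surjective = proj₁ (proj₂ (proj₂ (proj₂ (proj₂ σ-auto))))

    σ-mono-≤ : ∀ {x y} → x ≤ y → σ x ≤ σ y
    σ-mono-≤ {x} {y} = proj₂ (proj₂ (proj₂ (proj₂ (proj₂ σ-auto)))) x y

    σ-0 : σ 0# ≡ 0#
    σ-0 = x+x≈x⇒x≈0 (σ 0#) (sym (trans (cong σ (sym (+-identityʳ 0#))) (σ-+ 0# 0#)))

    σ-neg : ∀ x → σ (- x) ≡ - σ x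
    σ-neg x = +-inverseʳ-unique (σ x) (σ (- x))
      (trans (sym (σ-+ x (- x))) (trans (cong σ (-‿inverseʳ x)) σ-0))

    σ-cancel-≤ : ∀ {x y} → σ x ≤ σ y → x ≤ y
    σ-cancel-≤ {x} {y} σx≤σy with total x y
    ... | inj₁ x≤y = x≤y
    ... | inj₂ y≤x = ≤-reflexive (σ-injective x y (antisym σx≤σy (σ-mono-≤ y≤x)))

    ∣∣≤-σ : ∀ {c t} → ∣ t ∣≤ c → ∣ σ t ∣≤ σ c
    ∣∣≤-σ {c} (l , u) = subst (_≤ _) (σ-neg c) (σ-mono-≤ l) , σ-mono-≤ u

    ∣∣≤-σ⁻ : ∀ {c t} → ∣ σ t ∣≤ σ c → ∣ t ∣≤ c
    ∣∣≤-σ⁻ {c} (l , u) = σ-cancel-≤ (subst (_≤ _) (sym (σ-neg c)) l) , σ-cancel-≤ u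

    infix 4 _≼_
    _≼_ : Carrier → Carrier → Set
    a ≼ b = Γle K σ a b ⊎ σΓEq K σ a b

    module ConvexσSubring {S : Subset K} (S-subring : IsSubring K S) (S-convex : IsConvex K S)
                          (S-compatible : IsσCompatible K σ S) where

      private
        0∈S : S 0#
        0∈S = proj₁ S-subring
        1∈S : S 1#
        1∈S = proj₁ (proj₂ S-subring)
        +-closed : ∀ x y → S x → S y → S (x + y)
        +-closed = proj₁ (proj₂ (proj₂ S-subring))
        *-closed : ∀ x y → S x → S y → S (x * y)
        *-closed = proj₁ (proj₂ (proj₂ (proj₂ S-subring)))
        -‿closed : ∀ x → S x → S (- x)
        -‿closed = proj₂ (proj₂ (proj₂ (proj₂ S-subring)))

      -- w_S(1) ≤ w_S(x) turns into w_S(1) ≤ w_S(σ x), i.e. σ x ∈ S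
      σ-closed : ∀ {x} → S x → S (σ x)
      σ-closed {x} x∈S with Equivalence.to (S-compatible 1# x) (x , x∈S , sym (*-identityʳ x))
      ... | r , r∈S , σx≡rσ1 =
        subst S (sym (trans σx≡rσ1 (trans (cong (r *_) σ-1) (*-identityʳ r)))) r∈S

      σ^-closed : ∀ {x} m → S x → S (σ^ K σ m x)
      σ^-closed zero    x∈S = x∈S
      σ^-closed (suc m) x∈S = σ-closed (σ^-closed m x∈S)

      ∣∣≤-closed : ∀ {c x} → S c → ∣ x ∣≤ c → S x
      ∣∣≤-closed {c} {x} c∈S (l , u) =
        S-convex (- c) x c (-‿closed c c∈S) c∈S l u

      fromℕ∈S : ∀ n → S (fromℕ n)
      fromℕ∈S zero    = 0∈S
      fromℕ∈S (suc n) = +-closed _ _ 1∈S (fromℕ∈S n)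

      Rv⊆S : _⊆_ K (Rv K) S
      Rv⊆S x (n , bound) = ∣∣≤-closed (fromℕ∈S n) bound

      ^-closed : ∀ {x} n → S x → S (x ^ n)
      ^-closed zero    x∈S = 1∈S
      ^-closed (suc n) x∈S = *-closed _ _ x∈S (^-closed n x∈S)

      v-closed : ∀ {c x} → S c → vle K σ c x → S x
      v-closed c∈S (r , r∈Rv , x≡rc) =
        subst S (sym x≡rc) (*-closed _ _ (Rv⊆S _ r∈Rv) c∈S)

      Γle-closed : ∀ {c x} → S c → Γle K σ c x → S x
      Γle-closed c∈S (inj₁ c≤x)             = v-closed c∈S c≤x
      Γle-closed c∈S (inj₂ (n , c^2ⁿ≤x , _)) = v-closed (^-closed (2^ n) c∈S) c^2ⁿ≤x

      ≼-closed : ∀ {c x} → S c → c ≼ x → S x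
      ≼-closed c∈S (inj₁ c≤x)           = Γle-closed c∈S c≤x
      ≼-closed c∈S (inj₂ (n , σⁿc≤x , _)) = Γle-closed (σ^-closed n c∈S) σⁿc≤x

    module _ (σ-sq : ∀ a → P K a → a * a ≤ σ a) where

      Infinite⇒x*x≤σx : ∀ {x} → Infinite x → x * x ≤ σ x
      Infinite⇒x*x≤σx {x} x∞ = σ-sq x (Infinite⇒P x∞)

      Infinite⇒x≤σx : ∀ {x} → Infinite x → x ≤ σ x
      Infinite⇒x≤σx x∞ = ≤-trans (Infinite⇒x≤x*x x∞) (Infinite⇒x*x≤σx x∞)

      Infinite⇒x+x≤σx : ∀ {x} → Infinite x → x + x ≤ σ x
      Infinite⇒x+x≤σx x∞ = ≤-trans (Infinite⇒x+x≤x*x x∞) (Infinite⇒x*x≤σx x∞)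

      σ^-Infinite : ∀ {x} m → Infinite x → Infinite (σ^ K σ m x)
      σ^-Infinite zero    x∞ = x∞
      σ^-Infinite (suc m) x∞ = Infinite-mono (σ^-Infinite m x∞) (Infinite⇒x≤σx (σ^-Infinite m x∞))

      σ^-mono : ∀ {x m n} → Infinite x → m ≤′ n → σ^ K σ m x ≤ σ^ K σ n x
      σ^-mono x∞ ≤′-refl             = ≤-refl
      σ^-mono x∞ (≤′-step {n} m≤′n) =
        ≤-trans (σ^-mono x∞ m≤′n) (Infinite⇒x≤σx (σ^-Infinite n x∞))

      module Generated (a : Carrier) (a∞ : Infinite a) where

        ⟨a⟩ : Subset K
        ⟨a⟩ x = ∃ λ m → ∣ x ∣≤ σ^ K σ m a

        a∈⟨a⟩ : ⟨a⟩ a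
        a∈⟨a⟩ = 0 , 0≤t≤c⇒∣t∣≤c (Infinite⇒0≤ a∞) ≤-refl

        ∣∣≤1⇒∈⟨a⟩ : ∀ {x} → ∣ x ∣≤ 1# → ⟨a⟩ x
        ∣∣≤1⇒∈⟨a⟩ ∣x∣≤1 = 0 , ∣∣≤-weaken (Infinite⇒1≤ a∞) ∣x∣≤1

        common-bound : ∀ {x y} → ⟨a⟩ x → ⟨a⟩ y
                     → ∃ λ m → ∣ x ∣≤ σ^ K σ m a × ∣ y ∣≤ σ^ K σ m a
        common-bound (m , ∣x∣≤) (k , ∣y∣≤) =
          m ⊔ k , ∣∣≤-weaken (σ^-mono a∞ (≤⇒≤′ (m≤m⊔n m k))) ∣x∣≤
                , ∣∣≤-weaken (σ^-mono a∞ (≤⇒≤′ (m≤n⊔m m k))) ∣y∣≤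

        ⟨a⟩-isSubring : IsSubring K ⟨a⟩
        ⟨a⟩-isSubring =
          ∣∣≤1⇒∈⟨a⟩ (0≤t≤c⇒∣t∣≤c ≤-refl 0≤1) , ∣∣≤1⇒∈⟨a⟩ (0≤t≤c⇒∣t∣≤c 0≤1 ≤-refl) ,
          +-closed , *-closed , λ _ (m , ∣x∣≤) → m , ∣-t∣≤c ∣x∣≤
          where
          +-closed : ∀ x y → ⟨a⟩ x → ⟨a⟩ y → ⟨a⟩ (x + y)
          +-closed _ _ x∈ y∈ with common-bound x∈ y∈
          ... | m , ∣x∣≤ , ∣y∣≤ =
            suc m , ∣∣≤-weaken (Infinite⇒x+x≤σx (σ^-Infinite m a∞)) (∣+∣≤ ∣x∣≤ ∣y∣≤)
          *-closed : ∀ x y → ⟨a⟩ x → ⟨a⟩ y → ⟨a⟩ (x * y)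
          *-closed _ _ x∈ y∈ with common-bound x∈ y∈
          ... | m , ∣x∣≤ , ∣y∣≤ =
            suc m , ∣∣≤-weaken (Infinite⇒x*x≤σx (σ^-Infinite m a∞)) (∣*∣≤ ∣x∣≤ ∣y∣≤)

        ⟨a⟩-isValuationRing : IsValuationRing K ⟨a⟩
        ⟨a⟩-isValuationRing = ⟨a⟩-isSubring , x∈⊎x⁻¹∈
          where
          x∈⊎x⁻¹∈ : ∀ x → x ≢ 0# → ⟨a⟩ x ⊎ (∃ λ y → (x * y ≡ 1#) × ⟨a⟩ y)
          x∈⊎x⁻¹∈ x x≢0 with inverse x x≢0
          ... | y , xy≡1 with x*y≡1⇒∣x∣≤1⊎∣y∣≤1 xy≡1
          ...   | inj₁ ∣x∣≤1 = inj₁ (∣∣≤1⇒∈⟨a⟩ ∣x∣≤1)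
          ...   | inj₂ ∣y∣≤1 = inj₂ (y , xy≡1 , ∣∣≤1⇒∈⟨a⟩ ∣y∣≤1)

        ⟨a⟩-isConvex : IsConvex K ⟨a⟩
        ⟨a⟩-isConvex x y z x∈ z∈ x≤y y≤z with common-bound x∈ z∈
        ... | m , (l , _) , (_ , u) = m , ≤-trans l x≤y , ≤-trans y≤z u

        σ-closed : ∀ {x} → ⟨a⟩ x → ⟨a⟩ (σ x)
        σ-closed (m , ∣x∣≤) = suc m , ∣∣≤-σ ∣x∣≤

        σ⁻-closed : ∀ {x} → ⟨a⟩ (σ x) → ⟨a⟩ x
        σ⁻-closed (zero  , ∣σx∣≤a)    = 0 , ∣∣≤-σ⁻ (∣∣≤-weaken (Infinite⇒x≤σx a∞) ∣σx∣≤a)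
        σ⁻-closed (suc m , ∣σx∣≤σᵐ⁺¹a) = m , ∣∣≤-σ⁻ ∣σx∣≤σᵐ⁺¹a

        ⟨a⟩-isσCompatible : IsσCompatible K σ ⟨a⟩
        ⟨a⟩-isσCompatible x y = mk⇔ to from
          where
          to : wle K ⟨a⟩ x y → wle K ⟨a⟩ (σ x) (σ y)
          to (r , r∈ , y≡rx) = σ r , σ-closed r∈ , trans (cong σ y≡rx) (σ-* r x)
          from : wle K ⟨a⟩ (σ x) (σ y) → wle K ⟨a⟩ x y
          from (r , r∈ , σy≡rσx) with σ-surjective r
          ... | s , refl = s , σ⁻-closed r∈ , σ-injective y (s * x) (trans σy≡rσx (sym (σ-* s x)))

        ⟨a⟩-minimal : ∀ S → IsSubring K S → IsConvex K S → IsσCompatible K σ S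
                    → S a → _⊆_ K ⟨a⟩ S
        ⟨a⟩-minimal S S-subring S-convex S-compatible a∈S x (m , ∣x∣≤σᵐa) =
          ∣∣≤-closed (σ^-closed m a∈S) ∣x∣≤σᵐa
          where open ConvexσSubring S-subring S-convex S-compatible

        ⟨a⟩-isσPrincipal : IsσPrincipal K σ ⟨a⟩
        ⟨a⟩-isσPrincipal =
          ⟨a⟩-isValuationRing , ⟨a⟩-isConvex , ⟨a⟩-isσCompatible ,
          (λ (⟨a⟩⊆Rv , _) → proj₂ (Infinite⇒P a∞) (⟨a⟩⊆Rv a a∈⟨a⟩)) ,
          a , Infinite⇒P a∞ , a∈⟨a⟩ , ⟨a⟩-minimal

        -- |b| ≤ σᵐ a with b ≤ a or a ≤ b ≤ σᵐ a ≤ σᵐ b; either way [a] ≤ [b]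
        ∈⟨a⟩⇒a≼ : ∀ {b} → Infinite b → ⟨a⟩ b → a ≼ b
        ∈⟨a⟩⇒a≼ {b} b∞ (m , _ , b≤σᵐa) with total b a
        ... | inj₁ b≤a = inj₁ (inj₁ (0≤x≤y⇒v[y]≤v[x] (Infinite⇒0≤ b∞) b≤a (Infinite⇒0< a∞)))
        ... | inj₂ a≤b = inj₂ (m , inj₁ v[σᵐa]≤v[b] , inj₁ v[σᵐb]≤v[a])
          where
          v[σᵐa]≤v[b] : vle K σ (σ^ K σ m a) b
          v[σᵐa]≤v[b] = 0≤x≤y⇒v[y]≤v[x] (Infinite⇒0≤ b∞) b≤σᵐa
                    (Infinite⇒0< (σ^-Infinite m a∞))
          v[σᵐb]≤v[a] : vle K σ (σ^ K σ m b) a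
          v[σᵐb]≤v[a] = 0≤x≤y⇒v[y]≤v[x] (Infinite⇒0≤ a∞)
                    (≤-trans a≤b (σ^-mono {m = 0} {n = m} b∞ z≤′n))
                    (Infinite⇒0< (σ^-Infinite m b∞))

      generator : Rpr K σ → Q K σ
      generator (_ , (_ , _ , _ , _ , a , a∈P , _)) = a , a∈P

      ⊆⇔generator-≥ : ∀ (R R' : Rpr K σ)
                    → _⊆_ K (proj₁ R) (proj₁ R') ⇔ _≤Q_ K σ (generator R') (generator R)
      ⊆⇔generator-≥
        (R  , ((R-subring , _)  , R-convex  , R-compatible  , _ , a , a∈P , a∈R  , R-minimal))
        (R' , ((R'-subring , _) , R'-convex , R'-compatible , _ , b , b∈P , b∈R' , R'-minimal))
        = mk⇔ ⊆⇒b≼a b≼a⇒⊆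
        where
        open Generated b (P⇒Infinite b∈P)
        ⊆⇒b≼a : _⊆_ K R R' → b ≼ a
        ⊆⇒b≼a R⊆R' = ∈⟨a⟩⇒a≼ (P⇒Infinite a∈P)
          (R'-minimal ⟨a⟩ ⟨a⟩-isSubring ⟨a⟩-isConvex ⟨a⟩-isσCompatible a∈⟨a⟩ a (R⊆R' a a∈R))
        b≼a⇒⊆ : b ≼ a → _⊆_ K R R'
        b≼a⇒⊆ b≼a = R-minimal R' R'-subring R'-convex R'-compatible
          (ConvexσSubring.≼-closed R'-subring R'-convex R'-compatible b∈R' b≼a)

      generator-surjective : ∀ (q : Q K σ) → ∃ λ (R : Rpr K σ) → _≈Q_ K σ (generator R) q
      generator-surjective (a , a∈P) =
        (⟨a⟩ , ⟨a⟩-isσPrincipal) , 0 , inj₁ (v[x]≤v[x] a) , inj₁ (v[x]≤v[x] a)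
        where open Generated a (P⇒Infinite a∈P)

corollary5p4 : (K : OrderedField) → NonArchimedean K
    → (σ : OrderedField.Carrier K → OrderedField.Carrier K)
    → IsOrderPreservingAutomorphism K σ
    → ¬ (∀ x → σ x ≡ x)
    → (∀ a → P K a → OrderedField._≤_ K (OrderedField._*_ K a a) (σ a))
    → OrderIsoToReversed K σ
corollary5p4 K _ σ σ-auto _ σ-sq =
  generator K σ σ-auto σ-sq , ⊆⇔generator-≥ K σ σ-auto σ-sq , generator-surjective K σ σ-auto σ-sq
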